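{- For $N\in\mathbb{N}$, \begin{equation*} \sum_{n=1}^{N}\left[\begin{matrix} N \\ n\end{matrix}\right] \frac{(q)_n \left(\frac{c}{d}\right)_n (-zd)^n q^\frac{n(n+1)}{2}}{(zq)_n (cq)_n}= \frac{z}{c}(c-d)\sum_{n=1}^{N}\left[\begin{matrix} N \\ n\end{matrix}\right] \frac{(q)_n \left(\frac{zdq}{c}\right)_{n-1} (cq)_{N-n} (cq)^n}{(zq)_n (cq)_N}. \end{equation*}
   Context: $|q|<1$; $(a)_n=(a;q)_n=(1-a)(1-aq)\cdots(1-aq^{n-1})$ with $(a)_0=1$. The $q$-binomial coefficient is $\left[\begin{matrix} N \\ n\end{matrix}\right]=\frac{(q)_N}{(q)_n(q)_{N-n}}$ for $0\le n\le N$ and $0$ otherwise. Parameters $z,c,d$ are complex with all denominators nonzero. -}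

module Defs where

open import Level using (Level; _⊔_) renaming (suc to lsuc)
open import Data.Nat as ℕ using (ℕ; zero; suc; _∸_; _≤?_)
open import Data.Nat.DivMod using (_/_)
open import Relation.Nullary using (¬_; yes; no)
open import Algebra.Bundles using (CommutativeRing)

record Field (a ℓ : Level) : Set (lsuc (a ⊔ ℓ)) where
  field
    commutativeRing : CommutativeRing a ℓ
  open CommutativeRing commutativeRing public
  field
    inv        : Carrier → Carrier
    inv-inverse : ∀ x → ¬ (x ≈ 0#) → (x * inv x) ≈ 1#
    0≉1        : ¬ (0# ≈ 1#)

module QNotation {a ℓ : Level} (F : Field a ℓ) where
  open Field F

  pow : Carrier → ℕ → Carrier
  pow x zero    = 1#
  pow x (suc n) = pow x n * x

  poch : Carrier → Carrier → ℕ → Carrier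
  poch q x zero    = 1#
  poch q x (suc n) = poch q x n * (1# - x * pow q n)

  qbinom : Carrier → ℕ → ℕ → Carrier
  qbinom q N n with n ≤? N
  ... | yes _ = poch q q N * inv (poch q q n * poch q q (N ∸ n))
  ... | no  _ = 0#

  sum1 : ℕ → (ℕ → Carrier) → Carrier
  sum1 zero    f = 0#
  sum1 (suc N) f = sum1 N f + f (suc N)

  tri : ℕ → ℕ
  tri n = (n ℕ.* suc n) / 2

{-# OPTIONS --safe #-}

-- With w = cq and D n = (q)_N / (q)_(N-n), multiplying both sides by (cq)_N turns them into
-- Σ_n D n (w q^n; q)_(N-n) a_n and Σ_n D n (w; q)_(N-n) b_n for explicit product sequences a, b.
-- The first kind of weight expands triangularly in the second with coefficients w^(t-k) [t k]_q,
-- so after exchanging the sums the identity reduces, coefficient by coefficient, to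
-- Σ_k w^(t-k) [t k]_q a_(k+1) = b_(t+1): a q-binomial-type expansion of a finite product,
-- proved by induction on t with the q-Pascal rule.
module Submission where

open import Defs
open import Level using (Level)
open import Algebra.Bundles using (CommutativeRing)
import Algebra.Properties.CommutativeSemigroup as CommutativeSemigroupProperties
import Algebra.Properties.Ring
import Algebra.Solver.Ring
import Algebra.Solver.Ring.AlmostCommutativeRing as ACR
open import Data.Empty using (⊥-elim)
open import Data.Integer as ℤ using (ℤ; +_; -[1+_]; _⊖_; ∣_∣; sign)
import Data.Integer.Properties as ℤ
open import Data.Maybe using (Maybe; just; nothing)
open import Data.Nat as ℕ using (ℕ; zero; suc; _∸_; _≤_; _<_; z≤n; s≤s; _≤?_)
import Data.Nat.Properties as ℕ
open import Data.Nat.DivMod using (_/_; m*n/n≡m; +-distrib-/-∣ʳ)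
open import Data.Nat.Divisibility using (divides)
open import Data.Nat.Tactic.RingSolver using (solve-∀)
open import Data.Sign as Sign using (Sign)
open import Data.Sum using (inj₁; inj₂)
open import Function using (_∘_)
open import Relation.Nullary using (¬_; yes; no)
open import Relation.Binary.PropositionalEquality as ≡ using (_≡_)
import Relation.Binary.Reasoning.Setoid as SetoidReasoning

-- The ring solver decides identities only over a coefficient ring with computable
-- equality, so the ring is viewed as a ℤ-algebra through the canonical map ℤ → R.
module IntegerRingSolver {a ℓ : Level} (R : CommutativeRing a ℓ) where
  open CommutativeRing R
  open Algebra.Properties.Ring ring
  open SetoidReasoning setoid

  -- Defined so that ⟦ 1 ⟧ℕ is 1# on the nose, letting the solver's constant 1 read as 1#.
  ⟦_⟧ℕ : ℕ → Carrier
  ⟦ zero ⟧ℕ        = 0#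
  ⟦ suc zero ⟧ℕ    = 1#
  ⟦ suc (suc n) ⟧ℕ = 1# + ⟦ suc n ⟧ℕ

  ⟦suc⟧ℕ : ∀ n → ⟦ suc n ⟧ℕ ≈ 1# + ⟦ n ⟧ℕ
  ⟦suc⟧ℕ zero    = sym (+-identityʳ 1#)
  ⟦suc⟧ℕ (suc n) = refl

  ⟦+⟧ℕ : ∀ m n → ⟦ m ℕ.+ n ⟧ℕ ≈ ⟦ m ⟧ℕ + ⟦ n ⟧ℕ
  ⟦+⟧ℕ zero    n = sym (+-identityˡ _)
  ⟦+⟧ℕ (suc m) n = begin
    ⟦ suc (m ℕ.+ n) ⟧ℕ      ≈⟨ ⟦suc⟧ℕ (m ℕ.+ n) ⟩
    1# + ⟦ m ℕ.+ n ⟧ℕ       ≈⟨ +-congˡ (⟦+⟧ℕ m n) ⟩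
    1# + (⟦ m ⟧ℕ + ⟦ n ⟧ℕ)  ≈⟨ +-assoc _ _ _ ⟨
    (1# + ⟦ m ⟧ℕ) + ⟦ n ⟧ℕ  ≈⟨ +-congʳ (⟦suc⟧ℕ m) ⟨
    ⟦ suc m ⟧ℕ + ⟦ n ⟧ℕ     ∎

  ⟦*⟧ℕ : ∀ m n → ⟦ m ℕ.* n ⟧ℕ ≈ ⟦ m ⟧ℕ * ⟦ n ⟧ℕ
  ⟦*⟧ℕ zero    n = sym (zeroˡ _)
  ⟦*⟧ℕ (suc m) n = begin
    ⟦ n ℕ.+ m ℕ.* n ⟧ℕ             ≈⟨ ⟦+⟧ℕ n (m ℕ.* n) ⟩
    ⟦ n ⟧ℕ + ⟦ m ℕ.* n ⟧ℕ          ≈⟨ +-cong (sym (*-identityˡ _)) (⟦*⟧ℕ m n) ⟩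
    1# * ⟦ n ⟧ℕ + ⟦ m ⟧ℕ * ⟦ n ⟧ℕ  ≈⟨ distribʳ _ _ _ ⟨
    (1# + ⟦ m ⟧ℕ) * ⟦ n ⟧ℕ         ≈⟨ *-congʳ (⟦suc⟧ℕ m) ⟨
    ⟦ suc m ⟧ℕ * ⟦ n ⟧ℕ            ∎

  ⟦_⟧ℤ : ℤ → Carrier
  ⟦ + n ⟧ℤ     = ⟦ n ⟧ℕ
  ⟦ -[1+ n ] ⟧ℤ = - ⟦ suc n ⟧ℕ

  ⟦⊖⟧ℤ : ∀ m n → ⟦ m ⊖ n ⟧ℤ ≈ ⟦ m ⟧ℕ - ⟦ n ⟧ℕ
  ⟦⊖⟧ℤ zero    zero    = sym (-‿inverseʳ 0#)
  ⟦⊖⟧ℤ zero    (suc n) = sym (+-identityˡ _)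
  ⟦⊖⟧ℤ (suc m) zero    = sym (trans (+-congˡ -0#≈0#) (+-identityʳ _))
  ⟦⊖⟧ℤ (suc m) (suc n) = begin
    ⟦ suc m ⊖ suc n ⟧ℤ                   ≡⟨ ≡.cong ⟦_⟧ℤ (ℤ.[1+m]⊖[1+n]≡m⊖n m n) ⟩
    ⟦ m ⊖ n ⟧ℤ                           ≈⟨ ⟦⊖⟧ℤ m n ⟩
    ⟦ m ⟧ℕ - ⟦ n ⟧ℕ                      ≈⟨ +-identityˡ _ ⟨
    0# + (⟦ m ⟧ℕ - ⟦ n ⟧ℕ)               ≈⟨ +-congʳ (-‿inverseʳ 1#) ⟨
    (1# - 1#) + (⟦ m ⟧ℕ - ⟦ n ⟧ℕ)        ≈⟨ +-assoc _ _ _ ⟩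
    1# + (- 1# + (⟦ m ⟧ℕ - ⟦ n ⟧ℕ))      ≈⟨ +-congˡ (+-assoc _ _ _) ⟨
    1# + ((- 1# + ⟦ m ⟧ℕ) - ⟦ n ⟧ℕ)      ≈⟨ +-congˡ (+-congʳ (+-comm _ _)) ⟩
    1# + ((⟦ m ⟧ℕ - 1#) - ⟦ n ⟧ℕ)        ≈⟨ +-congˡ (+-assoc _ _ _) ⟩
    1# + (⟦ m ⟧ℕ + (- 1# - ⟦ n ⟧ℕ))      ≈⟨ +-assoc _ _ _ ⟨
    (1# + ⟦ m ⟧ℕ) + (- 1# - ⟦ n ⟧ℕ)      ≈⟨ +-cong (⟦suc⟧ℕ m) (trans (-‿cong (⟦suc⟧ℕ n)) (sym (-‿+-comm 1# _))) ⟨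
    ⟦ suc m ⟧ℕ - ⟦ suc n ⟧ℕ              ∎

  ⟦-⟧ℤ : ∀ i → ⟦ ℤ.- i ⟧ℤ ≈ - ⟦ i ⟧ℤ
  ⟦-⟧ℤ (+ zero)   = sym -0#≈0#
  ⟦-⟧ℤ (+ suc n)  = refl
  ⟦-⟧ℤ -[1+ n ]   = sym (-‿involutive _)

  ⟦+⟧ℤ : ∀ i j → ⟦ i ℤ.+ j ⟧ℤ ≈ ⟦ i ⟧ℤ + ⟦ j ⟧ℤ
  ⟦+⟧ℤ -[1+ m ] -[1+ n ] = begin
    - ⟦ suc (suc m ℕ.+ n) ⟧ℕ           ≈⟨ -‿cong (⟦suc⟧ℕ (suc m ℕ.+ n)) ⟩
    - (1# + ⟦ suc m ℕ.+ n ⟧ℕ)          ≈⟨ -‿cong (+-congˡ (⟦+⟧ℕ (suc m) n)) ⟩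
    - (1# + (⟦ suc m ⟧ℕ + ⟦ n ⟧ℕ))     ≈⟨ -‿cong (+-assoc _ _ _) ⟨
    - ((1# + ⟦ suc m ⟧ℕ) + ⟦ n ⟧ℕ)     ≈⟨ -‿cong (+-congʳ (+-comm _ _)) ⟩
    - ((⟦ suc m ⟧ℕ + 1#) + ⟦ n ⟧ℕ)     ≈⟨ -‿cong (+-assoc _ _ _) ⟩
    - (⟦ suc m ⟧ℕ + (1# + ⟦ n ⟧ℕ))     ≈⟨ -‿cong (+-congˡ (⟦suc⟧ℕ n)) ⟨
    - (⟦ suc m ⟧ℕ + ⟦ suc n ⟧ℕ)        ≈⟨ -‿+-comm _ _ ⟨
    - ⟦ suc m ⟧ℕ - ⟦ suc n ⟧ℕ          ∎
  ⟦+⟧ℤ -[1+ m ] (+ n)    = trans (⟦⊖⟧ℤ n (suc m)) (+-comm _ _)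
  ⟦+⟧ℤ (+ m)    -[1+ n ] = ⟦⊖⟧ℤ m (suc n)
  ⟦+⟧ℤ (+ m)    (+ n)    = ⟦+⟧ℕ m n

  ⟦_⟧± : Sign → Carrier
  ⟦ Sign.+ ⟧± = 1#
  ⟦ Sign.- ⟧± = - 1#

  ⟦*⟧± : ∀ s t → ⟦ s Sign.* t ⟧± ≈ ⟦ s ⟧± * ⟦ t ⟧±
  ⟦*⟧± Sign.+ _      = sym (*-identityˡ _)
  ⟦*⟧± Sign.- Sign.+ = sym (*-identityʳ _)
  ⟦*⟧± Sign.- Sign.- = begin
    1#              ≈⟨ -‿involutive _ ⟨
    - - 1#          ≈⟨ -‿cong (-1*x≈-x _) ⟨
    - (- 1# * 1#)   ≈⟨ -‿distribʳ-* _ _ ⟩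
    - 1# * - 1#     ∎

  ⟦◃⟧ℤ : ∀ s n → ⟦ s ℤ.◃ n ⟧ℤ ≈ ⟦ s ⟧± * ⟦ n ⟧ℕ
  ⟦◃⟧ℤ s      zero    = sym (zeroʳ _)
  ⟦◃⟧ℤ Sign.+ (suc n) = sym (*-identityˡ _)
  ⟦◃⟧ℤ Sign.- (suc n) = sym (-1*x≈-x _)

  ⟦*⟧ℤ : ∀ i j → ⟦ i ℤ.* j ⟧ℤ ≈ ⟦ i ⟧ℤ * ⟦ j ⟧ℤ
  ⟦*⟧ℤ i j = begin
    ⟦ i ℤ.* j ⟧ℤ                                ≈⟨ ⟦◃⟧ℤ _ (∣ i ∣ ℕ.* ∣ j ∣) ⟩
    ⟦ s Sign.* t ⟧± * ⟦ ∣ i ∣ ℕ.* ∣ j ∣ ⟧ℕ       ≈⟨ *-cong (⟦*⟧± s t) (⟦*⟧ℕ ∣ i ∣ ∣ j ∣) ⟩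
    (⟦ s ⟧± * ⟦ t ⟧±) * (⟦ ∣ i ∣ ⟧ℕ * ⟦ ∣ j ∣ ⟧ℕ)  ≈⟨ *-assoc _ _ _ ⟩
    ⟦ s ⟧± * (⟦ t ⟧± * (⟦ ∣ i ∣ ⟧ℕ * ⟦ ∣ j ∣ ⟧ℕ))  ≈⟨ *-congˡ (*-assoc _ _ _) ⟨
    ⟦ s ⟧± * ((⟦ t ⟧± * ⟦ ∣ i ∣ ⟧ℕ) * ⟦ ∣ j ∣ ⟧ℕ)  ≈⟨ *-congˡ (*-congʳ (*-comm _ _)) ⟩
    ⟦ s ⟧± * ((⟦ ∣ i ∣ ⟧ℕ * ⟦ t ⟧±) * ⟦ ∣ j ∣ ⟧ℕ)  ≈⟨ *-congˡ (*-assoc _ _ _) ⟩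
    ⟦ s ⟧± * (⟦ ∣ i ∣ ⟧ℕ * (⟦ t ⟧± * ⟦ ∣ j ∣ ⟧ℕ))  ≈⟨ *-assoc _ _ _ ⟨
    (⟦ s ⟧± * ⟦ ∣ i ∣ ⟧ℕ) * (⟦ t ⟧± * ⟦ ∣ j ∣ ⟧ℕ)  ≈⟨ *-cong (signAbs i) (signAbs j) ⟨
    ⟦ i ⟧ℤ * ⟦ j ⟧ℤ                             ∎
    where
    s = sign i
    t = sign j
    signAbs : ∀ k → ⟦ k ⟧ℤ ≈ ⟦ sign k ⟧± * ⟦ ∣ k ∣ ⟧ℕ
    signAbs (+ n)     = sym (*-identityˡ _)
    signAbs -[1+ n ]  = sym (-1*x≈-x _)

  ℤ⟶R : ℤ.+-*-rawRing ACR.-Raw-AlmostCommutative⟶ ACR.fromCommutativeRing R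
  ℤ⟶R = record
    { ⟦_⟧ = ⟦_⟧ℤ ; +-homo = ⟦+⟧ℤ ; *-homo = ⟦*⟧ℤ ; -‿homo = ⟦-⟧ℤ ; 0-homo = refl ; 1-homo = refl }

  ⟦≟⟧ℤ : ∀ i j → Maybe (⟦ i ⟧ℤ ≈ ⟦ j ⟧ℤ)
  ⟦≟⟧ℤ i j with i ℤ.≟ j
  ... | yes ≡.refl = just refl
  ... | no _       = nothing

  open Algebra.Solver.Ring ℤ.+-*-rawRing (ACR.fromCommutativeRing R) ℤ⟶R ⟦≟⟧ℤ public

  1ₚ : ∀ {n} → Polynomial n
  1ₚ = con (ℤ.+ 1)

  0ₚ : ∀ {n} → Polynomial n
  0ₚ = con (ℤ.+ 0)

module QSeries {a ℓ : Level} (F : Field a ℓ) where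
  open Field F hiding (zero)
  open QNotation F

  tri-suc : ∀ n → tri (suc n) ≡ tri n ℕ.+ suc n
  tri-suc n = begin
    (suc n ℕ.* suc (suc n)) / 2          ≡⟨ ≡.cong (_/ 2) (expand n) ⟩
    (n ℕ.* suc n ℕ.+ suc n ℕ.* 2) / 2    ≡⟨ +-distrib-/-∣ʳ (n ℕ.* suc n) (divides (suc n) ≡.refl) ⟩
    tri n ℕ.+ (suc n ℕ.* 2) / 2          ≡⟨ ≡.cong (tri n ℕ.+_) (m*n/n≡m (suc n) 2) ⟩
    tri n ℕ.+ suc n                      ∎
    where
    open ≡.≡-Reasoning
    expand : ∀ n → suc n ℕ.* suc (suc n) ≡ n ℕ.* suc n ℕ.+ suc n ℕ.* 2
    expand = solve-∀

  open IntegerRingSolver commutativeRing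
  open SetoidReasoning setoid
  open CommutativeSemigroupProperties *-commutativeSemigroup using (x∙yz≈y∙xz)
  open CommutativeSemigroupProperties +-commutativeSemigroup using ()
    renaming (x∙yz≈y∙xz to x+[y+z]≈y+[x+z])

  ≉0-* : ∀ {x y} → ¬ (x ≈ 0#) → ¬ (y ≈ 0#) → ¬ (x * y ≈ 0#)
  ≉0-* {x} {y} x≉0 y≉0 xy≈0 = y≉0 (begin
    y                ≈⟨ *-identityˡ y ⟨
    1# * y           ≈⟨ *-congʳ (inv-inverse x x≉0) ⟨
    (x * inv x) * y  ≈⟨ solve 3 (λ x i y → (x :* i) :* y := i :* (x :* y)) refl x (inv x) y ⟩
    inv x * (x * y)  ≈⟨ *-congˡ xy≈0 ⟩
    inv x * 0#       ≈⟨ zeroʳ _ ⟩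
    0#               ∎)

  inv-unique : ∀ {x y} → ¬ (x ≈ 0#) → x * y ≈ 1# → y ≈ inv x
  inv-unique {x} {y} x≉0 xy≈1 = begin
    y                ≈⟨ *-identityʳ y ⟨
    y * 1#           ≈⟨ *-congˡ (inv-inverse x x≉0) ⟨
    y * (x * inv x)  ≈⟨ solve 3 (λ x y i → y :* (x :* i) := (x :* y) :* i) refl x y (inv x) ⟩
    (x * y) * inv x  ≈⟨ *-congʳ xy≈1 ⟩
    1# * inv x       ≈⟨ *-identityˡ _ ⟩
    inv x            ∎

  inv-distrib-* : ∀ {x y} → ¬ (x ≈ 0#) → ¬ (y ≈ 0#) → inv (x * y) ≈ inv x * inv y
  inv-distrib-* {x} {y} x≉0 y≉0 = sym (inv-unique (≉0-* x≉0 y≉0) (begin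
    (x * y) * (inv x * inv y)    ≈⟨ solve 4 (λ x y i j → (x :* y) :* (i :* j) := (x :* i) :* (y :* j)) refl x y (inv x) (inv y) ⟩
    (x * inv x) * (y * inv y)    ≈⟨ *-cong (inv-inverse x x≉0) (inv-inverse y y≉0) ⟩
    1# * 1#                      ≈⟨ *-identityˡ 1# ⟩
    1#                           ∎))

  inv-by-cofactor : ∀ {x y z} → x * y ≈ z → ¬ (z ≈ 0#) → inv x ≈ y * inv z
  inv-by-cofactor {x} {y} {z} xy≈z z≉0 = sym (inv-unique x≉0 (begin
    x * (y * inv z)  ≈⟨ *-assoc x y (inv z) ⟨
    (x * y) * inv z  ≈⟨ *-congʳ xy≈z ⟩
    z * inv z        ≈⟨ inv-inverse z z≉0 ⟩
    1#               ∎))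
    where
    x≉0 : ¬ (x ≈ 0#)
    x≉0 x≈0 = z≉0 (trans (sym xy≈z) (trans (*-congʳ x≈0) (zeroˡ y)))

  -- The solver treats inv x as an opaque atom, so an identity that needs
  -- x * inv x ≈ 1# is checked by the solver up to a multiple of x * inv x - 1#.
  modulo-unit : ∀ {l r k e} → e ≈ 1# → l ≈ r + k * (e - 1#) → l ≈ r
  modulo-unit {l} {r} {k} {e} e≈1 l≈ = begin
    l                 ≈⟨ l≈ ⟩
    r + k * (e - 1#)  ≈⟨ +-congˡ (*-congˡ (trans (+-congʳ e≈1) (-‿inverseʳ 1#))) ⟩
    r + k * 0#        ≈⟨ +-congˡ (zeroʳ k) ⟩
    r + 0#            ≈⟨ +-identityʳ r ⟩
    r                 ∎

  ∑< : ℕ → (ℕ → Carrier) → Carrier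
  ∑< zero    f = 0#
  ∑< (suc n) f = ∑< n f + f n

  sum1≡∑< : ∀ N (f : ℕ → Carrier) → sum1 N f ≡ ∑< N (f ∘ suc)
  sum1≡∑< zero    f = ≡.refl
  sum1≡∑< (suc N) f = ≡.cong (_+ f (suc N)) (sum1≡∑< N f)

  ∑<-cong : ∀ n {f g} → (∀ k → k < n → f k ≈ g k) → ∑< n f ≈ ∑< n g
  ∑<-cong zero    f≈g = refl
  ∑<-cong (suc n) f≈g = +-cong (∑<-cong n (λ k k<n → f≈g k (ℕ.m<n⇒m<1+n k<n))) (f≈g n ℕ.≤-refl)

  ∑<-distrib-+ : ∀ n (f g : ℕ → Carrier) → ∑< n (λ k → f k + g k) ≈ ∑< n f + ∑< n g
  ∑<-distrib-+ zero    f g = sym (+-identityˡ 0#)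
  ∑<-distrib-+ (suc n) f g = begin
    ∑< n (λ k → f k + g k) + (f n + g n)  ≈⟨ +-congʳ (∑<-distrib-+ n f g) ⟩
    (∑< n f + ∑< n g) + (f n + g n)       ≈⟨ solve 4 (λ a b c d → (a :+ b) :+ (c :+ d) := (a :+ c) :+ (b :+ d)) refl (∑< n f) (∑< n g) (f n) (g n) ⟩
    (∑< n f + f n) + (∑< n g + g n)       ∎

  ∑<-distribˡ : ∀ n x (f : ℕ → Carrier) → ∑< n (λ k → x * f k) ≈ x * ∑< n f
  ∑<-distribˡ zero    x f = sym (zeroʳ x)
  ∑<-distribˡ (suc n) x f = trans (+-congʳ (∑<-distribˡ n x f)) (sym (distribˡ x _ _))

  ∑<-distribʳ : ∀ n x (f : ℕ → Carrier) → ∑< n (λ k → f k * x) ≈ ∑< n f * x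
  ∑<-distribʳ zero    x f = sym (zeroˡ x)
  ∑<-distribʳ (suc n) x f = trans (+-congʳ (∑<-distribʳ n x f)) (sym (distribʳ x _ _))

  ∑<-head : ∀ n (f : ℕ → Carrier) → ∑< (suc n) f ≈ f 0 + ∑< n (f ∘ suc)
  ∑<-head zero    f = trans (+-identityˡ _) (sym (+-identityʳ _))
  ∑<-head (suc n) f = trans (+-congʳ (∑<-head n f)) (+-assoc _ _ _)

  ∑<-zero : ∀ n (f : ℕ → Carrier) → (∀ k → k < n → f k ≈ 0#) → ∑< n f ≈ 0#
  ∑<-zero n f f≈0 = trans (∑<-cong n f≈0) (zeros n)
    where
    zeros : ∀ n → ∑< n (λ _ → 0#) ≈ 0#
    zeros zero    = refl
    zeros (suc n) = trans (+-identityʳ _) (zeros n)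

  ∑<-vanishing-tail : ∀ {m n} (f : ℕ → Carrier) → m ≤ n → (∀ k → m ≤ k → k < n → f k ≈ 0#) → ∑< n f ≈ ∑< m f
  ∑<-vanishing-tail {n = zero} f z≤n _ = refl
  ∑<-vanishing-tail {m} {suc n} f m≤1+n f≈0 with ℕ.m≤n⇒m<n∨m≡n m≤1+n
  ... | inj₂ ≡.refl    = refl
  ... | inj₁ (s≤s m≤n) = begin
    ∑< n f + f n  ≈⟨ +-cong (∑<-vanishing-tail f m≤n (λ k m≤k k<n → f≈0 k m≤k (ℕ.m<n⇒m<1+n k<n))) (f≈0 n m≤n ℕ.≤-refl) ⟩
    ∑< m f + 0#   ≈⟨ +-identityʳ _ ⟩
    ∑< m f        ∎

  ∑<-comm : ∀ m n (h : ℕ → ℕ → Carrier) → ∑< m (λ i → ∑< n (h i)) ≈ ∑< n (λ j → ∑< m (λ i → h i j))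
  ∑<-comm zero    n h = sym (∑<-zero n _ (λ _ _ → refl))
  ∑<-comm (suc m) n h = begin
    ∑< m (λ i → ∑< n (h i)) + ∑< n (h m)              ≈⟨ +-congʳ (∑<-comm m n h) ⟩
    ∑< n (λ j → ∑< m (λ i → h i j)) + ∑< n (h m)      ≈⟨ ∑<-distrib-+ n _ _ ⟨
    ∑< n (λ j → ∑< m (λ i → h i j) + h m j)           ∎

  pow-+ : ∀ x m n → pow x (m ℕ.+ n) ≈ pow x m * pow x n
  pow-+ x m zero = begin
    pow x (m ℕ.+ 0)  ≡⟨ ≡.cong (pow x) (ℕ.+-identityʳ m) ⟩
    pow x m          ≈⟨ *-identityʳ _ ⟨
    pow x m * 1#     ∎
  pow-+ x m (suc n) = begin
    pow x (m ℕ.+ suc n)        ≡⟨ ≡.cong (pow x) (ℕ.+-suc m n) ⟩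
    pow x (m ℕ.+ n) * x        ≈⟨ *-congʳ (pow-+ x m n) ⟩
    (pow x m * pow x n) * x    ≈⟨ *-assoc _ _ _ ⟩
    pow x m * (pow x n * x)    ∎

  pow-tri-suc : ∀ q n → pow q (tri (suc n)) ≈ pow q (tri n) * pow q (suc n)
  pow-tri-suc q n = trans (reflexive (≡.cong (pow q) (tri-suc n))) (pow-+ q (tri n) (suc n))

  poch-cong : ∀ q {x y} n → x ≈ y → poch q x n ≈ poch q y n
  poch-cong q zero    x≈y = refl
  poch-cong q (suc n) x≈y = *-cong (poch-cong q n x≈y) (+-congˡ (-‿cong (*-congʳ x≈y)))

  poch-+ : ∀ q x m n → poch q x (m ℕ.+ n) ≈ poch q x m * poch q (x * pow q m) n
  poch-+ q x m zero = begin
    poch q x (m ℕ.+ 0)  ≡⟨ ≡.cong (poch q x) (ℕ.+-identityʳ m) ⟩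
    poch q x m          ≈⟨ *-identityʳ _ ⟨
    poch q x m * 1#     ∎
  poch-+ q x m (suc n) = begin
    poch q x (m ℕ.+ suc n)                                     ≡⟨ ≡.cong (poch q x) (ℕ.+-suc m n) ⟩
    poch q x (m ℕ.+ n) * (1# - x * pow q (m ℕ.+ n))            ≈⟨ *-cong (poch-+ q x m n) (+-congˡ (-‿cong (*-congˡ (pow-+ q m n)))) ⟩
    (A * B) * (1# - x * (Qm * Qn))                             ≈⟨ solve 5 (λ A B x a b → (A :* B) :* (1ₚ :- x :* (a :* b)) := A :* (B :* (1ₚ :- (x :* a) :* b))) refl A B x Qm Qn ⟩
    A * (B * (1# - (x * Qm) * Qn))                             ∎
    where
    A = poch q x m
    B = poch q (x * pow q m) n
    Qm = pow q m
    Qn = pow q n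

  poch-+-∸ : ∀ q x {k N} → k ≤ N → poch q x k * poch q (x * pow q k) (N ∸ k) ≈ poch q x N
  poch-+-∸ q x {k} {N} k≤N = begin
    poch q x k * poch q (x * pow q k) (N ∸ k)  ≈⟨ poch-+ q x k (N ∸ k) ⟨
    poch q x (k ℕ.+ (N ∸ k))                   ≡⟨ ≡.cong (poch q x) (ℕ.m+[n∸m]≡n k≤N) ⟩
    poch q x N                                 ∎

  poch-suc : ∀ q x n → poch q x (suc n) ≈ (1# - x) * poch q (x * q) n
  poch-suc q x n = begin
    poch q x (1 ℕ.+ n)                     ≈⟨ poch-+ q x 1 n ⟩
    poch q x 1 * poch q (x * pow q 1) n    ≈⟨ *-cong (solve 1 (λ x → 1ₚ :* (1ₚ :- x :* 1ₚ) := 1ₚ :- x) refl x) (poch-cong q n (*-congˡ (*-identityˡ q))) ⟩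
    (1# - x) * poch q (x * q) n            ∎

  poch-≤-≉0 : ∀ q x {k N} → k ≤ N → ¬ (poch q x N ≈ 0#) → ¬ (poch q x k ≈ 0#)
  poch-≤-≉0 q x k≤N pN≉0 pk≈0 =
    pN≉0 (trans (sym (poch-+-∸ q x k≤N)) (trans (*-congʳ pk≈0) (zeroˡ _)))

  module QFalling (q : Carrier) where

    qFalling : ℕ → ℕ → Carrier
    qFalling N       zero    = 1#
    qFalling zero    (suc n) = 0#
    qFalling (suc N) (suc n) = (1# - pow q (suc N)) * qFalling N n

    qFalling-*-poch : ∀ {N n} → n ≤ N → qFalling N n * poch q q (N ∸ n) ≈ poch q q N
    qFalling-*-poch {N}     {zero}  _         = *-identityˡ _
    qFalling-*-poch {suc N} {suc n} (s≤s n≤N) = begin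
      ((1# - pow q N * q) * qFalling N n) * poch q q (N ∸ n)  ≈⟨ *-assoc _ _ _ ⟩
      (1# - pow q N * q) * (qFalling N n * poch q q (N ∸ n))  ≈⟨ *-congˡ (qFalling-*-poch n≤N) ⟩
      (1# - pow q N * q) * poch q q N                         ≈⟨ solve 3 (λ Q q P → (1ₚ :- Q :* q) :* P := P :* (1ₚ :- q :* Q)) refl (pow q N) q (poch q q N) ⟩
      poch q q N * (1# - q * pow q N)                         ∎

    qbinom-*-poch : ∀ {N n} → ¬ (poch q q N ≈ 0#) → n ≤ N → qbinom q N n * poch q q n ≈ qFalling N n
    qbinom-*-poch {N} {n} pN≉0 n≤N with n ≤? N
    ... | no n≰N = ⊥-elim (n≰N n≤N)
    ... | yes _  = begin
      poch q q N * inv (Pn * PN-n) * Pn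
        ≈⟨ *-congʳ (*-congʳ (qFalling-*-poch n≤N)) ⟨
      (qFalling N n * PN-n) * inv (Pn * PN-n) * Pn
        ≈⟨ solve 4 (λ D a b i → (D :* b) :* i :* a := D :* ((a :* b) :* i)) refl (qFalling N n) Pn PN-n (inv (Pn * PN-n)) ⟩
      qFalling N n * ((Pn * PN-n) * inv (Pn * PN-n))
        ≈⟨ *-congˡ (inv-inverse _ (≉0-* (poch-≤-≉0 q q n≤N pN≉0) (poch-≤-≉0 q q (ℕ.m∸n≤m N n) pN≉0))) ⟩
      qFalling N n * 1#
        ≈⟨ *-identityʳ _ ⟩
      qFalling N n ∎
      where
      Pn = poch q q n
      PN-n = poch q q (N ∸ n)

    -- (a q; q)_m - (a; q)_m = a (1 - q^m) (a q; q)_(m-1), with a = y q^j and m = N - j.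
    qFalling-poch-step : ∀ y N j →
      qFalling N j * poch q (y * pow q (suc j)) (N ∸ j)
        ≈ qFalling N j * poch q (y * pow q j) (N ∸ j)
          + y * pow q j * (qFalling N (suc j) * poch q (y * pow q (suc j)) (N ∸ suc j))
    qFalling-poch-step y zero zero =
      solve 1 (λ y → 1ₚ :* 1ₚ := 1ₚ :* 1ₚ :+ y :* 1ₚ :* (0ₚ :* 1ₚ)) refl y
    qFalling-poch-step y zero (suc j) =
      solve 2 (λ y Q → 0ₚ :* 1ₚ := 0ₚ :* 1ₚ :+ y :* Q :* (0ₚ :* 1ₚ)) refl y (pow q (suc j))
    qFalling-poch-step y (suc N) zero = begin
      1# * (A * (1# - (y * (1# * q)) * pow q N))
        ≈⟨ solve 4 (λ A y q Q → 1ₚ :* (A :* (1ₚ :- (y :* (1ₚ :* q)) :* Q))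
                              := 1ₚ :* ((1ₚ :- y :* 1ₚ) :* A) :+ y :* 1ₚ :* (((1ₚ :- Q :* q) :* 1ₚ) :* A))
                   refl A y q (pow q N) ⟩
      1# * ((1# - y * 1#) * A) + y * 1# * (((1# - pow q N * q) * 1#) * A)
        ≈⟨ +-congʳ (*-congˡ (trans (poch-suc q (y * 1#) N) (*-congˡ (poch-cong q N [y1]q≈)))) ⟨
      1# * poch q (y * 1#) (suc N) + y * 1# * (((1# - pow q N * q) * 1#) * A) ∎
      where
      A = poch q (y * (1# * q)) N
      [y1]q≈ : (y * 1#) * q ≈ y * (1# * q)
      [y1]q≈ = solve 2 (λ y q → (y :* 1ₚ) :* q := y :* (1ₚ :* q)) refl y q
    qFalling-poch-step y (suc N) (suc j) = begin
      ((1# - Q) * D) * poch q (y * pow q (suc (suc j))) (N ∸ j)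
        ≈⟨ *-congˡ (poch-cong q (N ∸ j) y[q²Qj]≈) ⟩
      ((1# - Q) * D) * P₁
        ≈⟨ *-assoc _ _ _ ⟩
      (1# - Q) * (D * P₁)
        ≈⟨ *-congˡ (qFalling-poch-step (y * q) N j) ⟩
      (1# - Q) * (D * P₂ + (y * q) * Qj * (D′ * P₃))
        ≈⟨ solve 8 (λ Q D D′ P₂ P₃ y q Qj → (1ₚ :- Q) :* (D :* P₂ :+ (y :* q) :* Qj :* (D′ :* P₃))
                                          := ((1ₚ :- Q) :* D) :* P₂ :+ y :* (Qj :* q) :* (((1ₚ :- Q) :* D′) :* P₃))
                   refl Q D D′ P₂ P₃ y q Qj ⟩
      ((1# - Q) * D) * P₂ + y * (Qj * q) * (((1# - Q) * D′) * P₃)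
        ≈⟨ +-cong (*-congˡ (poch-cong q (N ∸ j) (sym y[qQj]≈)))
                  (*-congˡ (*-congˡ (poch-cong q (N ∸ suc j) (sym y[q²Qj]≈)))) ⟩
      ((1# - Q) * D) * poch q (y * pow q (suc j)) (N ∸ j)
        + y * pow q (suc j) * (((1# - Q) * D′) * poch q (y * pow q (suc (suc j))) (N ∸ suc j)) ∎
      where
      Q = pow q (suc N)
      Qj = pow q j
      D = qFalling N j
      D′ = qFalling N (suc j)
      P₁ = poch q ((y * q) * pow q (suc j)) (N ∸ j)
      P₂ = poch q ((y * q) * pow q j) (N ∸ j)
      P₃ = poch q ((y * q) * pow q (suc j)) (N ∸ suc j)
      y[qQj]≈ : y * pow q (suc j) ≈ (y * q) * pow q j
      y[qQj]≈ = solve 3 (λ y Q q → y :* (Q :* q) := (y :* q) :* Q) refl y Qj q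
      y[q²Qj]≈ : y * pow q (suc (suc j)) ≈ (y * q) * pow q (suc j)
      y[q²Qj]≈ = solve 3 (λ y Q q → y :* ((Q :* q) :* q) := (y :* q) :* (Q :* q)) refl y Qj q

  module Gaussian (q w : Carrier) where
    open QFalling q

    -- gaussian t k = w ^ (t - k) * [t k]_q, generated by the q-Pascal rule.
    gaussian : ℕ → ℕ → Carrier
    gaussian zero    zero    = 1#
    gaussian zero    (suc k) = 0#
    gaussian (suc t) zero    = w * gaussian t zero
    gaussian (suc t) (suc k) = gaussian t k + w * pow q (suc k) * gaussian t (suc k)

    gaussian-vanishes : ∀ {t k} → t < k → gaussian t k ≈ 0#
    gaussian-vanishes {zero}  {suc k} _         = refl
    gaussian-vanishes {suc t} {suc k} (s≤s t<k) = begin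
      gaussian t k + w * pow q (suc k) * gaussian t (suc k)  ≈⟨ +-cong (gaussian-vanishes t<k) (*-congˡ (gaussian-vanishes (ℕ.m<n⇒m<1+n t<k))) ⟩
      0# + w * pow q (suc k) * 0#                            ≈⟨ trans (+-identityˡ _) (zeroʳ _) ⟩
      0#                                                     ∎

    ∑<-gaussian-suc : ∀ t (g : ℕ → Carrier) →
      ∑< (suc (suc t)) (λ k → gaussian (suc t) k * g k)
        ≈ ∑< (suc t) (λ k → gaussian t k * (g (suc k) + w * pow q k * g k))
    ∑<-gaussian-suc t g = begin
      ∑< (suc (suc t)) (λ k → gaussian (suc t) k * g k)
        ≈⟨ ∑<-head (suc t) _ ⟩
      w * gaussian t 0 * g 0 + ∑< (suc t) (λ k → (gaussian t k + w * pow q (suc k) * gaussian t (suc k)) * g (suc k))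
        ≈⟨ +-cong (solve 3 (λ w G g → w :* G :* g := w :* 1ₚ :* G :* g) refl w (gaussian t 0) (g 0))
                  (∑<-cong (suc t) (λ k _ → distribʳ _ _ _)) ⟩
      H 0 + ∑< (suc t) (λ k → gaussian t k * g (suc k) + H (suc k))
        ≈⟨ +-congˡ (∑<-distrib-+ (suc t) _ _) ⟩
      H 0 + (∑< (suc t) A + ∑< (suc t) (H ∘ suc))
        ≈⟨ x+[y+z]≈y+[x+z] _ _ _ ⟩
      ∑< (suc t) A + (H 0 + ∑< (suc t) (H ∘ suc))
        ≈⟨ +-congˡ (∑<-head (suc t) H) ⟨
      ∑< (suc t) A + ∑< (suc (suc t)) H
        ≈⟨ +-congˡ (∑<-vanishing-tail H (ℕ.n≤1+n (suc t)) (λ k t<k _ → H-vanishes t<k)) ⟩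
      ∑< (suc t) A + ∑< (suc t) H
        ≈⟨ ∑<-distrib-+ (suc t) A H ⟨
      ∑< (suc t) (λ k → A k + H k)
        ≈⟨ ∑<-cong (suc t) (λ k _ → solve 5 (λ G a w Q b → G :* a :+ w :* Q :* G :* b := G :* (a :+ w :* Q :* b))
                                                refl (gaussian t k) (g (suc k)) w (pow q k) (g k)) ⟩
      ∑< (suc t) (λ k → gaussian t k * (g (suc k) + w * pow q k * g k)) ∎
      where
      A H : ℕ → Carrier
      A k = gaussian t k * g (suc k)
      H k = w * pow q k * gaussian t k * g k
      H-vanishes : ∀ {k} → t < k → H k ≈ 0#
      H-vanishes t<k = trans (*-congʳ (trans (*-congˡ (gaussian-vanishes t<k)) (zeroʳ _))) (zeroˡ _)

    weight shiftedWeight : ℕ → ℕ → Carrier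
    weight        N n = qFalling N n * poch q w (N ∸ n)
    shiftedWeight N n = qFalling N n * poch q (w * pow q n) (N ∸ n)

    shiftedWeight-expansion : ∀ N k →
      ∑< N (λ t → weight N (suc t) * gaussian t k) ≈ shiftedWeight N (suc k)
    shiftedWeight-expansion zero    k = sym (zeroˡ _)
    shiftedWeight-expansion (suc N) k = begin
      ∑< (suc N) (λ t → weight (suc N) (suc t) * gaussian t k)
        ≈⟨ ∑<-cong (suc N) (λ t _ → trans (*-congʳ (*-assoc _ _ _)) (*-assoc _ _ _)) ⟩
      ∑< (suc N) (λ t → (1# - Q) * (weight N t * gaussian t k))
        ≈⟨ ∑<-distribˡ (suc N) _ _ ⟩
      (1# - Q) * ∑< (suc N) (λ t → weight N t * gaussian t k)
        ≈⟨ *-congˡ (∑<-head N _) ⟩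
      (1# - Q) * (weight N 0 * gaussian 0 k + ∑< N (λ t → weight N (suc t) * gaussian (suc t) k))
        ≈⟨ *-congˡ (pascal k) ⟩
      (1# - Q) * (shiftedWeight N k + w * pow q k * shiftedWeight N (suc k))
        ≈⟨ *-congˡ (qFalling-poch-step w N k) ⟨
      (1# - Q) * (qFalling N k * poch q (w * pow q (suc k)) (N ∸ k))
        ≈⟨ *-assoc _ _ _ ⟨
      shiftedWeight (suc N) (suc k) ∎
      where
      Q = pow q (suc N)
      pascal : ∀ k → weight N 0 * gaussian 0 k + ∑< N (λ t → weight N (suc t) * gaussian (suc t) k)
                     ≈ shiftedWeight N k + w * pow q k * shiftedWeight N (suc k)
      pascal zero = begin
        weight N 0 * 1# + ∑< N (λ t → weight N (suc t) * (w * gaussian t 0))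
          ≈⟨ +-cong (trans (*-identityʳ _) (*-congˡ (poch-cong q N (sym (*-identityʳ w)))))
                    (∑<-cong N (λ t _ → x∙yz≈y∙xz _ _ _)) ⟩
        shiftedWeight N 0 + ∑< N (λ t → w * (weight N (suc t) * gaussian t 0))
          ≈⟨ +-congˡ (∑<-distribˡ N w _) ⟩
        shiftedWeight N 0 + w * ∑< N (λ t → weight N (suc t) * gaussian t 0)
          ≈⟨ +-congˡ (*-cong (sym (*-identityʳ w)) (shiftedWeight-expansion N 0)) ⟩
        shiftedWeight N 0 + w * 1# * shiftedWeight N 1 ∎
      pascal (suc k) = begin
        weight N 0 * 0# + ∑< N (λ t → weight N (suc t) * (gaussian t k + w * pow q (suc k) * gaussian t (suc k)))
          ≈⟨ +-cong (zeroʳ _) (∑<-cong N (λ t _ → trans (distribˡ _ _ _) (+-congˡ (x∙yz≈y∙xz _ _ _)))) ⟩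
        0# + ∑< N (λ t → weight N (suc t) * gaussian t k + w * pow q (suc k) * (weight N (suc t) * gaussian t (suc k)))
          ≈⟨ trans (+-identityˡ _) (∑<-distrib-+ N _ _) ⟩
        ∑< N (λ t → weight N (suc t) * gaussian t k) + ∑< N (λ t → w * pow q (suc k) * (weight N (suc t) * gaussian t (suc k)))
          ≈⟨ +-cong (shiftedWeight-expansion N k) (trans (∑<-distribˡ N _ _) (*-congˡ (shiftedWeight-expansion N (suc k)))) ⟩
        shiftedWeight N (suc k) + w * pow q (suc k) * shiftedWeight N (suc (suc k)) ∎

    weight-transform : ∀ N (a b : ℕ → Carrier) →
      (∀ t → t < N → ∑< N (λ k → gaussian t k * a k) ≈ b t) →
      ∑< N (λ k → shiftedWeight N (suc k) * a k) ≈ ∑< N (λ t → weight N (suc t) * b t)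
    weight-transform N a b b≈ = begin
      ∑< N (λ k → shiftedWeight N (suc k) * a k)
        ≈⟨ ∑<-cong N (λ k _ → *-congʳ (shiftedWeight-expansion N k)) ⟨
      ∑< N (λ k → ∑< N (λ t → weight N (suc t) * gaussian t k) * a k)
        ≈⟨ ∑<-cong N (λ k _ → ∑<-distribʳ N (a k) _) ⟨
      ∑< N (λ k → ∑< N (λ t → weight N (suc t) * gaussian t k * a k))
        ≈⟨ ∑<-comm N N _ ⟩
      ∑< N (λ t → ∑< N (λ k → weight N (suc t) * gaussian t k * a k))
        ≈⟨ ∑<-cong N (λ t _ → trans (∑<-cong N (λ k _ → *-assoc _ _ _)) (∑<-distribˡ N _ _)) ⟩
      ∑< N (λ t → weight N (suc t) * ∑< N (λ k → gaussian t k * a k))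
        ≈⟨ ∑<-cong N (λ t t<N → *-congˡ (b≈ t t<N)) ⟩
      ∑< N (λ t → weight N (suc t) * b t) ∎

  module Products (q w d : Carrier) where
    open Gaussian q w

    α β : Carrier → ℕ → Carrier
    α u zero    = 1#
    α u (suc k) = α u k * (u * pow q k * (w * pow q k - d))
    β u zero    = 1#
    β u (suc t) = β u t * (w - u * d * pow q t)

    α-scale : ∀ u k → α (u * q) k ≈ pow q k * α u k
    α-scale u zero    = sym (*-identityˡ _)
    α-scale u (suc k) = begin
      α (u * q) k * ((u * q) * Q * (w * Q - d))        ≈⟨ *-congʳ (α-scale u k) ⟩
      (Q * α u k) * ((u * q) * Q * (w * Q - d))        ≈⟨ solve 6 (λ Q a u q w d → (Q :* a) :* ((u :* q) :* Q :* (w :* Q :- d))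
                                                                                := (Q :* q) :* (a :* (u :* Q :* (w :* Q :- d))))
                                                                 refl Q (α u k) u q w d ⟩
      (Q * q) * (α u k * (u * Q * (w * Q - d)))        ∎
      where
      Q = pow q k

    β-suc : ∀ u t → β u (suc t) ≈ (w - u * d) * β (u * q) t
    β-suc u zero    = solve 3 (λ w u d → 1ₚ :* (w :- u :* d :* 1ₚ) := (w :- u :* d) :* 1ₚ) refl w u d
    β-suc u (suc t) = begin
      β u (suc t) * (w - u * d * (Q * q))                  ≈⟨ *-congʳ (β-suc u t) ⟩
      ((w - u * d) * β (u * q) t) * (w - u * d * (Q * q))  ≈⟨ solve 6 (λ w u d B Q q → ((w :- u :* d) :* B) :* (w :- u :* d :* (Q :* q))
                                                                                    := (w :- u :* d) :* (B :* (w :- (u :* q) :* d :* Q)))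
                                                                     refl w u d (β (u * q) t) Q q ⟩
      (w - u * d) * (β (u * q) t * (w - (u * q) * d * Q))  ∎
      where
      Q = pow q t

    β-expansion-step : ∀ u t k → k ≤ t →
      α u (suc k) * poch q (u * pow q (suc k)) (t ∸ k) + w * pow q k * (α u k * poch q (u * pow q k) (suc t ∸ k))
        ≈ (w - u * d) * (α (u * q) k * poch q (u * q * pow q k) (t ∸ k))
    β-expansion-step u t k k≤t = begin
      A * (u * Q * (w * Q - d)) * poch q (u * pow q (suc k)) (t ∸ k) + w * Q * (A * poch q (u * Q) (suc t ∸ k))
        ≡⟨ ≡.cong (λ m → A * (u * Q * (w * Q - d)) * poch q (u * pow q (suc k)) (t ∸ k) + w * Q * (A * poch q (u * Q) m))
                  (ℕ.+-∸-assoc 1 k≤t) ⟩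
      A * (u * Q * (w * Q - d)) * poch q (u * pow q (suc k)) (t ∸ k) + w * Q * (A * poch q (u * Q) (suc (t ∸ k)))
        ≈⟨ +-cong (*-congˡ (poch-cong q (t ∸ k) u[Qq]≈))
                  (*-congˡ (*-congˡ (trans (poch-suc q (u * Q) (t ∸ k)) (*-congˡ (poch-cong q (t ∸ k) [uQ]q≈))))) ⟩
      A * (u * Q * (w * Q - d)) * P + w * Q * (A * ((1# - u * Q) * P))
        ≈⟨ solve 7 (λ A u Q w d q P → A :* (u :* Q :* (w :* Q :- d)) :* P :+ w :* Q :* (A :* ((1ₚ :- u :* Q) :* P))
                                     := (w :- u :* d) :* ((Q :* A) :* P))
                   refl A u Q w d q P ⟩
      (w - u * d) * ((Q * A) * P)
        ≈⟨ *-congˡ (*-congʳ (α-scale u k)) ⟨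
      (w - u * d) * (α (u * q) k * P) ∎
      where
      A = α u k
      Q = pow q k
      P = poch q (u * q * pow q k) (t ∸ k)
      u[Qq]≈ : u * (Q * q) ≈ u * q * Q
      u[Qq]≈ = solve 3 (λ u Q q → u :* (Q :* q) := u :* q :* Q) refl u Q q
      [uQ]q≈ : u * Q * q ≈ u * q * Q
      [uQ]q≈ = solve 3 (λ u Q q → u :* Q :* q := u :* q :* Q) refl u Q q

    β-expansion : ∀ u t →
      ∑< (suc t) (λ k → gaussian t k * (α u k * poch q (u * pow q k) (t ∸ k))) ≈ β u t
    β-expansion u zero    = trans (+-identityˡ _) (trans (*-identityˡ _) (*-identityˡ _))
    β-expansion u (suc t) = begin
      ∑< (suc (suc t)) (λ k → gaussian (suc t) k * g k)
        ≈⟨ ∑<-gaussian-suc t g ⟩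
      ∑< (suc t) (λ k → gaussian t k * (g (suc k) + w * pow q k * g k))
        ≈⟨ ∑<-cong (suc t) (λ k k<1+t → *-congˡ (β-expansion-step u t k (ℕ.≤-pred k<1+t))) ⟩
      ∑< (suc t) (λ k → gaussian t k * ((w - u * d) * h k))
        ≈⟨ ∑<-cong (suc t) (λ k _ → x∙yz≈y∙xz _ _ _) ⟩
      ∑< (suc t) (λ k → (w - u * d) * (gaussian t k * h k))
        ≈⟨ ∑<-distribˡ (suc t) _ _ ⟩
      (w - u * d) * ∑< (suc t) (λ k → gaussian t k * h k)
        ≈⟨ *-congˡ (β-expansion (u * q) t) ⟩
      (w - u * d) * β (u * q) t
        ≈⟨ β-suc u t ⟨
      β u (suc t) ∎
      where
      g h : ℕ → Carrier
      g k = α u k * poch q (u * pow q k) (suc t ∸ k)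
      h k = α (u * q) k * poch q (u * q * pow q k) (t ∸ k)

  module Corollary (q z c d : Carrier) (N : ℕ)
    (qN≉0 : ¬ (poch q q N ≈ 0#)) (c≉0 : ¬ (c ≈ 0#)) (d≉0 : ¬ (d ≈ 0#))
    (zqN≉0 : ¬ (poch q (z * q) N ≈ 0#)) (cqN≉0 : ¬ (poch q (c * q) N ≈ 0#)) where

    open QFalling q
    open Gaussian q (c * q)
    open Products q (c * q) d

    lhsSummand rhsSummand : ℕ → Carrier
    lhsSummand n = qbinom q N n
                   * (poch q q n * poch q (c * inv d) n * pow (- (z * d)) n * pow q (tri n))
                   * inv (poch q (z * q) n * poch q (c * q) n)
    rhsSummand n = qbinom q N n
                   * (poch q q n * poch q (z * d * q * inv c) (n ∸ 1) * poch q (c * q) (N ∸ n) * pow (c * q) n)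
                   * inv (poch q (z * q) n * poch q (c * q) N)

    u κ : Carrier
    u = z * q * q
    κ = z * q * (c - d)

    lhsCoeff rhsCoeff : ℕ → Carrier
    lhsCoeff k = κ * α u k * inv (poch q (z * q) (suc k))
    rhsCoeff t = κ * β u t * inv (poch q (z * q) (suc t))

    rhsCoeff-expansion : ∀ t → t < N → ∑< N (λ k → gaussian t k * lhsCoeff k) ≈ rhsCoeff t
    rhsCoeff-expansion t t<N = begin
      ∑< N (λ k → gaussian t k * lhsCoeff k)
        ≈⟨ ∑<-vanishing-tail _ t<N (λ k t<k _ → trans (*-congʳ (gaussian-vanishes t<k)) (zeroˡ _)) ⟩
      ∑< (suc t) (λ k → gaussian t k * lhsCoeff k)
        ≈⟨ ∑<-cong (suc t) (λ k k<1+t → term (ℕ.≤-pred k<1+t)) ⟩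
      ∑< (suc t) (λ k → κ * (gaussian t k * (α u k * poch q (u * pow q k) (t ∸ k))) * inv Zt)
        ≈⟨ ∑<-distribʳ (suc t) _ _ ⟩
      ∑< (suc t) (λ k → κ * (gaussian t k * (α u k * poch q (u * pow q k) (t ∸ k)))) * inv Zt
        ≈⟨ *-congʳ (∑<-distribˡ (suc t) _ _) ⟩
      κ * ∑< (suc t) (λ k → gaussian t k * (α u k * poch q (u * pow q k) (t ∸ k))) * inv Zt
        ≈⟨ *-congʳ (*-congˡ (β-expansion u t)) ⟩
      κ * β u t * inv Zt ∎
      where
      Zt = poch q (z * q) (suc t)
      term : ∀ {k} → k ≤ t → gaussian t k * lhsCoeff k ≈ κ * (gaussian t k * (α u k * poch q (u * pow q k) (t ∸ k))) * inv Zt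
      term {k} k≤t = begin
        gaussian t k * (κ * α u k * inv (poch q (z * q) (suc k)))
          ≈⟨ *-congˡ (*-congˡ (inv-by-cofactor (poch-+-∸ q (z * q) (s≤s k≤t)) (poch-≤-≉0 q (z * q) t<N zqN≉0))) ⟩
        gaussian t k * (κ * α u k * (poch q (z * q * pow q (suc k)) (t ∸ k) * inv Zt))
          ≈⟨ *-congˡ (*-congˡ (*-congʳ (poch-cong q (t ∸ k) zq[Qq]≈))) ⟩
        gaussian t k * (κ * α u k * (poch q (u * pow q k) (t ∸ k) * inv Zt))
          ≈⟨ solve 5 (λ G K a P I → G :* (K :* a :* (P :* I)) := K :* (G :* (a :* P)) :* I)
                     refl (gaussian t k) κ (α u k) (poch q (u * pow q k) (t ∸ k)) (inv Zt) ⟩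
        κ * (gaussian t k * (α u k * poch q (u * pow q k) (t ∸ k))) * inv Zt ∎
        where
        zq[Qq]≈ : z * q * pow q (suc k) ≈ u * pow q k
        zq[Qq]≈ = solve 3 (λ z q Q → z :* q :* (Q :* q) := z :* q :* q :* Q) refl z q (pow q k)

    lhs-product : ∀ k → poch q (c * inv d) (suc k) * pow (- (z * d)) (suc k) * pow q (tri (suc k)) ≈ κ * α u k
    lhs-product zero = modulo-unit (inv-inverse d d≉0)
      (solve 5 (λ z q c d i → (1ₚ :* (1ₚ :- (c :* i) :* 1ₚ)) :* (1ₚ :* (:- (z :* d))) :* (1ₚ :* q)
                              := z :* q :* (c :- d) :* 1ₚ :+ (z :* q :* c) :* (d :* i :- 1ₚ))
             refl z q c d (inv d))
    lhs-product (suc k) = begin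
      (Px * (1# - x * Q′)) * (Py * y) * pow q (tri (suc (suc k)))
        ≈⟨ *-congˡ (pow-tri-suc q (suc k)) ⟩
      (Px * (1# - x * Q′)) * (Py * y) * (Pt * pow q (suc (suc k)))
        ≈⟨ solve 7 (λ Px x Q₁ Py y Pt Q₂ → (Px :* (1ₚ :- x :* Q₁)) :* (Py :* y) :* (Pt :* Q₂)
                                        := (Px :* Py :* Pt) :* ((1ₚ :- x :* Q₁) :* y :* Q₂))
                   refl Px x Q′ Py y Pt (pow q (suc (suc k))) ⟩
      (Px * Py * Pt) * ((1# - x * Q′) * y * pow q (suc (suc k)))
        ≈⟨ *-congʳ (lhs-product k) ⟩
      (κ * α u k) * ((1# - x * Q′) * y * pow q (suc (suc k)))
        ≈⟨ modulo-unit (inv-inverse d d≉0)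
             (solve 8 (λ K a z q c d i Q → (K :* a) :* ((1ₚ :- (c :* i) :* (Q :* q)) :* (:- (z :* d)) :* ((Q :* q) :* q))
                                         := K :* (a :* (z :* q :* q :* Q :* (c :* q :* Q :- d)))
                                            :+ (K :* a :* z :* c :* q :* q :* q :* Q :* Q) :* (d :* i :- 1ₚ))
                    refl κ (α u k) z q c d (inv d) (pow q k)) ⟩
      κ * (α u k * (u * pow q k * (c * q * pow q k - d))) ∎
      where
      x = c * inv d
      y = - (z * d)
      Q′ = pow q (suc k)
      Px = poch q x (suc k)
      Py = pow y (suc k)
      Pt = pow q (tri (suc k))

    rhs-product : ∀ k → (z * inv c) * (c - d) * (poch q (z * d * q * inv c) k * pow (c * q) (suc k)) ≈ κ * β u k
    rhs-product zero = modulo-unit (inv-inverse c c≉0)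
      (solve 5 (λ z q c d i → (z :* i) :* (c :- d) :* (1ₚ :* (1ₚ :* (c :* q)))
                              := z :* q :* (c :- d) :* 1ₚ :+ (z :* q :* (c :- d)) :* (c :* i :- 1ₚ))
             refl z q c d (inv c))
    rhs-product (suc k) = begin
      X * ((Pv * (1# - v * pow q k)) * (Pw * (c * q)))
        ≈⟨ solve 7 (λ X Pv v Q Pw c q → X :* ((Pv :* (1ₚ :- v :* Q)) :* (Pw :* (c :* q)))
                                      := (X :* (Pv :* Pw)) :* ((1ₚ :- v :* Q) :* (c :* q)))
                   refl X Pv v (pow q k) Pw c q ⟩
      (X * (Pv * Pw)) * ((1# - v * pow q k) * (c * q))
        ≈⟨ *-congʳ (rhs-product k) ⟩
      (κ * β u k) * ((1# - v * pow q k) * (c * q))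
        ≈⟨ modulo-unit (inv-inverse c c≉0)
             (solve 8 (λ K B z q c d i Q → (K :* B) :* ((1ₚ :- (z :* d :* q :* i) :* Q) :* (c :* q))
                                         := K :* (B :* (c :* q :- z :* q :* q :* d :* Q))
                                            :+ (:- (K :* B :* z :* d :* q :* q :* Q)) :* (c :* i :- 1ₚ))
                    refl κ (β u k) z q c d (inv c) (pow q k)) ⟩
      κ * (β u k * (c * q - u * d * pow q k)) ∎
      where
      X = (z * inv c) * (c - d)
      v = z * d * q * inv c
      Pv = poch q v k
      Pw = pow (c * q) (suc k)

    lhs-term : ∀ k → k < N → lhsSummand (suc k) ≈ shiftedWeight N (suc k) * lhsCoeff k * inv (poch q (c * q) N)
    lhs-term k k<N = begin
      qb * (Pq * Px * Py * Pt) * inv (Zk * Ck)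
        ≈⟨ *-cong (*-congˡ (trans (solve 4 (λ a b c d → a :* b :* c :* d := a :* (b :* c :* d)) refl Pq Px Py Pt)
                                  (*-congˡ (lhs-product k))))
                  (trans (inv-distrib-* (poch-≤-≉0 q (z * q) k<N zqN≉0) (poch-≤-≉0 q (c * q) k<N cqN≉0))
                         (*-congˡ (inv-by-cofactor (poch-+-∸ q (c * q) k<N) cqN≉0))) ⟩
      qb * (Pq * (κ * α u k)) * (inv Zk * (E * inv CN))
        ≈⟨ solve 7 (λ b p K a I E J → b :* (p :* (K :* a)) :* (I :* (E :* J)) := (((b :* p) :* E) :* (K :* a :* I)) :* J)
                   refl qb Pq κ (α u k) (inv Zk) E (inv CN) ⟩
      qb * Pq * E * lhsCoeff k * inv CN
        ≈⟨ *-congʳ (*-congʳ (*-congʳ (qbinom-*-poch qN≉0 k<N))) ⟩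
      shiftedWeight N (suc k) * lhsCoeff k * inv CN ∎
      where
      qb = qbinom q N (suc k)
      Pq = poch q q (suc k)
      Px = poch q (c * inv d) (suc k)
      Py = pow (- (z * d)) (suc k)
      Pt = pow q (tri (suc k))
      Zk = poch q (z * q) (suc k)
      Ck = poch q (c * q) (suc k)
      CN = poch q (c * q) N
      E = poch q (c * q * pow q (suc k)) (N ∸ suc k)

    rhs-term : ∀ t → t < N → (z * inv c) * (c - d) * rhsSummand (suc t) ≈ weight N (suc t) * rhsCoeff t * inv (poch q (c * q) N)
    rhs-term t t<N = begin
      X * (qb * (Pq * Pv * Pc * Pw) * inv (Zt * CN))
        ≈⟨ solve 7 (λ X b p v c w I → X :* (b :* (p :* v :* c :* w) :* I) := ((b :* p) :* c) :* (X :* (v :* w)) :* I)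
                   refl X qb Pq Pv Pc Pw (inv (Zt * CN)) ⟩
      qb * Pq * Pc * (X * (Pv * Pw)) * inv (Zt * CN)
        ≈⟨ *-cong (*-cong (*-congʳ (qbinom-*-poch qN≉0 t<N)) (rhs-product t))
                  (inv-distrib-* (poch-≤-≉0 q (z * q) t<N zqN≉0) cqN≉0) ⟩
      qFalling N (suc t) * Pc * (κ * β u t) * (inv Zt * inv CN)
        ≈⟨ solve 5 (λ W K b I J → W :* (K :* b) :* (I :* J) := W :* (K :* b :* I) :* J)
                   refl (weight N (suc t)) κ (β u t) (inv Zt) (inv CN) ⟩
      weight N (suc t) * rhsCoeff t * inv CN ∎
      where
      X = (z * inv c) * (c - d)
      qb = qbinom q N (suc t)
      Pq = poch q q (suc t)
      Pv = poch q (z * d * q * inv c) t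
      Pc = poch q (c * q) (N ∸ suc t)
      Pw = pow (c * q) (suc t)
      Zt = poch q (z * q) (suc t)
      CN = poch q (c * q) N

corollary2p2 : {a ℓ : Level} (F : Field a ℓ) →
    let open Field F
        open QNotation F
    in (q z c d : Carrier) (N : ℕ) →
       ¬ (poch q q N ≈ 0#) →
       ¬ (c ≈ 0#) → ¬ (d ≈ 0#) →
       ¬ (poch q (z * q) N ≈ 0#) →
       ¬ (poch q (c * q) N ≈ 0#) →
       sum1 N (λ n → qbinom q N n
                     * (poch q q n * poch q (c * inv d) n
                        * pow (- (z * d)) n * pow q (tri n))
                     * inv (poch q (z * q) n * poch q (c * q) n))
       ≈ (z * inv c) * (c - d)
         * sum1 N (λ n → qbinom q N n
                         * (poch q q n * poch q (z * d * q * inv c) (n ∸ 1)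
                            * poch q (c * q) (N ∸ n) * pow (c * q) n)
                         * inv (poch q (z * q) n * poch q (c * q) N))
corollary2p2 F q z c d N qN≉0 c≉0 d≉0 zqN≉0 cqN≉0 = begin
  sum1 N lhsSummand
    ≡⟨ sum1≡∑< N lhsSummand ⟩
  ∑< N (lhsSummand ∘ suc)
    ≈⟨ ∑<-cong N lhs-term ⟩
  ∑< N (λ k → shiftedWeight N (suc k) * lhsCoeff k * inv CN)
    ≈⟨ ∑<-distribʳ N (inv CN) _ ⟩
  ∑< N (λ k → shiftedWeight N (suc k) * lhsCoeff k) * inv CN
    ≈⟨ *-congʳ (weight-transform N lhsCoeff rhsCoeff rhsCoeff-expansion) ⟩
  ∑< N (λ t → weight N (suc t) * rhsCoeff t) * inv CN
    ≈⟨ ∑<-distribʳ N (inv CN) _ ⟨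
  ∑< N (λ t → weight N (suc t) * rhsCoeff t * inv CN)
    ≈⟨ ∑<-cong N rhs-term ⟨
  ∑< N (λ t → (z * inv c) * (c - d) * rhsSummand (suc t))
    ≈⟨ ∑<-distribˡ N _ _ ⟩
  (z * inv c) * (c - d) * ∑< N (rhsSummand ∘ suc)
    ≡⟨ ≡.cong ((z * inv c) * (c - d) *_) (sum1≡∑< N rhsSummand) ⟨
  (z * inv c) * (c - d) * sum1 N rhsSummand ∎
  where
  open Field F hiding (zero)
  open QNotation F
  open QSeries F
  open Gaussian q (c * q)
  open Corollary q z c d N qN≉0 c≉0 d≉0 zqN≉0 cqN≉0
  open SetoidReasoning setoid
  CN = poch q (c * q) N
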